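{- Let $\mathcal{F}$ be a CNF formula and let $c_i, c_j \in \mathcal{F}$ with $(c_i,c_j) \in P_{\mathcal{F}}$. Then the edge $(c_i,c_j)$ is blocked if and only if the edge $(c_j,c_i)$ is blocked. (Note that $(c_i,c_j) \in P_{\mathcal{F}}$ if and only if $(c_j,c_i) \in P_{\mathcal{F}}$.)
   Context: A literal is a Boolean variable $x$ or its negation $\lnot x$, with $\lnot\lnot l = l$. A clause is a non-empty set of literals (a disjunction); a CNF formula $\mathcal{F}$ is a set of clauses (a conjunction). An assignment is a set of literals $a$ such that $l \in a$ implies $\lnot l \notin a$. The assignment $a$ satisfies a clause $c$ if $a \cap c \neq \emptyset$, and satisfies a formula if it satisfies all of its clauses. An assignment $a$ is complete for $\mathcal{F}$ if for every $c \in \mathcal{F}$ and every $l \in c$, either $l \in a$ or $\lnot l \in a$. An associated assignment (assoc) for a clause $c \in \mathcal{F}$ is a complete assignment for $\mathcal{F}$ that satisfies $\mathcal{F} \setminus \{c\}$ and does not satisfy $c$. The set of all assocs for $c$ is denoted $A(c,\mathcal{F})$. For an assignment $a$ and a literal $l$, define $\mathrm{flip}(a,l) = (a \setminus \{l\}) \cup \{\lnot l\}$. For clauses $c_i, c_j$, let $L(c_i,c_j) = \{ l \mid l \in c_i \text{ and } \lnot l \in c_j\}$. Define $P_{\mathcal{F}} = \{(c_i,c_j) \mid c_i, c_j \in \mathcal{F},\ |L(c_i,c_j)| = 1\}$. An edge $(c_i,c_j) \in P_{\mathcal{F}}$ is blocked if, where $l$ is the unique literal with $L(c_i,c_j) =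 \{l\}$, for every $a_i \in A(c_i,\mathcal{F})$ we have $\mathrm{flip}(a_i,\lnot l) \notin A(c_j,\mathcal{F})$. -}

module Defs where

open import Data.Nat using (ℕ)
open import Data.List using (List)
open import Data.List.Membership.Propositional using (_∈_)
open import Data.List.Relation.Unary.All using (All)
open import Data.List.Relation.Unary.Any using (Any)
open import Data.Product using (Σ; ∃; _×_)
open import Data.Sum using (_⊎_)
open import Relation.Binary.PropositionalEquality using (_≡_; _≢_)
open import Relation.Nullary using (¬_)
open import Level using (0ℓ)
open import Relation.Unary using (Pred)

data Literal : Set where
  pos : ℕ → Literal
  neg : ℕ → Literal

∼_ : Literal → Literal
∼ pos x = neg x
∼ neg x = pos x

-- A clause is a finite set of literals, represented by a list (read as a set:
-- only membership matters).  A formula is a finite set of clauses (list).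
Clause : Set
Clause = List Literal

Formula : Set
Formula = List Clause

NonEmpty : Clause → Set
NonEmpty c = Σ Literal λ l → l ∈ c

IsCNF : Formula → Set
IsCNF F = All NonEmpty F

_≐_ : Clause → Clause → Set
c ≐ d = (∀ l → l ∈ c → l ∈ d) × (∀ l → l ∈ d → l ∈ c)

Assignment : Set₁
Assignment = Pred Literal 0ℓ

Consistent : Assignment → Set
Consistent a = ∀ l → a l → ¬ a (∼ l)

SatClause : Assignment → Clause → Set
SatClause a c = Σ Literal λ l → l ∈ c × a l

Complete : Formula → Assignment → Set
Complete F a = ∀ c → c ∈ F → ∀ l → l ∈ c → a l ⊎ a (∼ l)

Assoc : Formula → Clause → Assignment → Set
Assoc F c a =
  Consistent a × Complete F a
  × (∀ d → d ∈ F → ¬ (d ≐ c) → SatClause a d)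
  × ¬ SatClause a c

flip : Assignment → Literal → Assignment
flip a l x = (a x × x ≢ l) ⊎ x ≡ ∼ l

InL : Clause → Clause → Literal → Set
InL ci cj l = l ∈ ci × (∼ l) ∈ cj

LSingleton : Clause → Clause → Literal → Set
LSingleton ci cj l = InL ci cj l × (∀ l' → InL ci cj l' → l' ≡ l)

InP : Formula → Clause → Clause → Set
InP F ci cj = ci ∈ F × cj ∈ F × ∃ λ l → LSingleton ci cj l

Blocked : Formula → Clause → Clause → Set₁
Blocked F ci cj =
  ∀ l → LSingleton ci cj l →
  ∀ (a : Assignment) → Assoc F ci a → ¬ Assoc F cj (flip a (∼ l))

-- The edge (cj, ci) inverts the edge (ci, cj): if a is an assoc of cj, then
-- a falsifies the clashing literal l of cj, so flipping ∼ l turns the candidate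
-- assoc b = flip(a, ∼ l) of ci back into a = flip(b, l).  A witness against
-- one edge being blocked is thus a witness against the other.

module Submission where

open import Defs
open import Data.Empty using (⊥-elim)
open import Data.List.Membership.Propositional using (_∈_)
open import Data.Nat as ℕ using ()
open import Data.Product using (_,_)
open import Data.Sum using (inj₁; inj₂)
import Data.Sum as Sum
open import Function.Bundles using (_⇔_; mk⇔)
open import Relation.Binary.PropositionalEquality using (_≡_; refl; sym; subst)
open import Relation.Nullary using (¬_; Dec; yes; no)
open import Relation.Unary using () renaming (_≐_ to _≐ₚ_)
open import Relation.Unary.Properties using (≐-sym)

∼-involutive : ∀ l → ∼ ∼ l ≡ l
∼-involutive (pos x) = refl
∼-involutive (neg x) = refl

_≟_ : (l m : Literal) → Dec (l ≡ m)
pos x ≟ pos y with x ℕ.≟ y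
... | yes refl = yes refl
... | no x≢y   = no λ { refl → x≢y refl }
pos x ≟ neg y = no λ ()
neg x ≟ pos y = no λ ()
neg x ≟ neg y with x ℕ.≟ y
... | yes refl = yes refl
... | no x≢y   = no λ { refl → x≢y refl }

Assoc-resp-≐ : ∀ {F c} {a b : Assignment} → a ≐ₚ b → Assoc F c a → Assoc F c b
Assoc-resp-≐ (a⊆b , b⊆a) (consistent , complete , satisfies , falsifies) =
  (λ l bl b∼l → consistent l (b⊆a bl) (b⊆a b∼l)) ,
  (λ d d∈F l l∈d → Sum.map a⊆b a⊆b (complete d d∈F l l∈d)) ,
  (λ d d∈F d≠c → let (l , l∈d , al) = satisfies d d∈F d≠c in l , l∈d , a⊆b al) ,
  λ { (l , l∈c , bl) → falsifies (l , l∈c , b⊆a bl) }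

flip-flip : ∀ (a : Assignment) {l} → a l → ¬ a (∼ l) → flip (flip a l) (∼ l) ≐ₚ a
flip-flip a {l} al a∼l≢ = to , from
  where
  to : ∀ {x} → flip (flip a l) (∼ l) x → a x
  to (inj₁ (inj₁ (ax , _) , _)) = ax
  to (inj₁ (inj₂ refl , x≢∼l))  = ⊥-elim (x≢∼l refl)
  to (inj₂ refl)                = subst a (sym (∼-involutive l)) al

  from : ∀ {x} → a x → flip (flip a l) (∼ l) x
  from {x} ax with x ≟ l
  ... | yes refl = inj₂ (sym (∼-involutive x))
  ... | no x≢l   = inj₁ (inj₁ (ax , x≢l) , λ { refl → a∼l≢ ax })

Assoc-falsifies : ∀ {F c a l} → c ∈ F → Assoc F c a → l ∈ c → a (∼ l)
Assoc-falsifies {l = l} c∈F (_ , complete , _ , falsifies) l∈c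
  with complete _ c∈F l l∈c
... | inj₁ al  = ⊥-elim (falsifies (l , l∈c , al))
... | inj₂ a∼l = a∼l

LSingleton-swap : ∀ {ci cj l} → LSingleton ci cj l → LSingleton cj ci (∼ l)
LSingleton-swap {ci} {cj} {l} ((l∈ci , ∼l∈cj) , unique) =
  (∼l∈cj , subst (_∈ ci) (sym (∼-involutive l)) l∈ci) , unique′
  where
  unique′ : ∀ m → InL cj ci m → m ≡ ∼ l
  unique′ m (m∈cj , ∼m∈ci) with unique (∼ m) (∼m∈ci , subst (_∈ cj) (sym (∼-involutive m)) m∈cj)
  ... | refl = sym (∼-involutive m)

Blocked-swap : ∀ {F ci cj} → cj ∈ F → Blocked F ci cj → Blocked F cj ci
Blocked-swap cj∈F blocked l clash@((l∈cj , _) , _) a assoc-cj@(_ , _ , _ , falsifies) assoc-ci =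
  blocked (∼ l) (LSingleton-swap clash) (flip a (∼ l)) assoc-ci
    (Assoc-resp-≐ (≐-sym (flip-flip a (Assoc-falsifies cj∈F assoc-cj l∈cj) ¬a∼∼l)) assoc-cj)
  where
  ¬a∼∼l : ¬ a (∼ ∼ l)
  ¬a∼∼l a∼∼l = falsifies (l , l∈cj , subst a (∼-involutive l) a∼∼l)

corollary1 : (F : Formula) → IsCNF F → (ci cj : Clause) → InP F ci cj →
    Blocked F ci cj ⇔ Blocked F cj ci
corollary1 F _ ci cj (ci∈F , cj∈F , _) = mk⇔ (Blocked-swap cj∈F) (Blocked-swap ci∈F)
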